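{- Let $G$ be a finite abelian group, and let $A$ be a nonempty subset of $G$ not contained in any proper subgroup of $G$. If $0 \in A$, then $w_G(A) \leq \left\lceil \frac{2|G|}{|A|} \right\rceil - 1$, while if $0 \notin A$, then $w_G(A) \leq \left\lceil \frac{2|G|}{|A|+1} \right\rceil$.
   Context: For $A\subseteq G$ and a positive integer $k$, $kA=\{x_1+\dots+x_k:x_i\in A\}$. For a nonempty $A\subseteq G$ not contained in any proper subgroup, the width $w_G(A)$ is the least positive integer $k$ such that $\bigcup_{1\le k'\le k}k'A=G$, i.e. every element of $G$ is a sum of at most $k$ elements of $A$ (repetitions allowed). -}

module Defs where

open import Data.Nat using (ℕ; zero; suc; _+_; _∸_; _/_; _≤_)
open import Data.Fin using (Fin)
open import Data.Fin.Subset using (Subset; _∈_; _∉_; _⊆_)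
open import Data.Vec using (Vec; []; _∷_; foldr)
open import Data.Vec.Relation.Unary.All using (All)
open import Data.Product using (Σ; ∃; _×_)
open import Relation.Binary.PropositionalEquality using (_≡_)
open import Relation.Nullary using (¬_)

-- ceiling division ⌈ a / b ⌉ for b ≥ 1 (value at b = 0 is irrelevant, set to 0)
ceilDiv : ℕ → ℕ → ℕ
ceilDiv a zero    = 0
ceilDiv a (suc b) = (a + b) / suc b

module _ {n : ℕ} (_∙_ : Fin n → Fin n → Fin n) (ε : Fin n) (_⁻¹ : Fin n → Fin n) where

  IsSubgroup : Subset n → Set
  IsSubgroup H = (ε ∈ H)
               × (∀ x y → x ∈ H → y ∈ H → (x ∙ y) ∈ H)
               × (∀ x → x ∈ H → (x ⁻¹) ∈ H)

  NotInProperSubgroup : Subset n → Set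
  NotInProperSubgroup A = ∀ H → IsSubgroup H → A ⊆ H → ∀ x → x ∈ H

  vsum : ∀ {k} → Vec (Fin n) k → Fin n
  vsum = foldr _ _∙_ ε

  InSumset : ℕ → Subset n → Fin n → Set
  InSumset k A g = Σ (Vec (Fin n) k) λ xs → All (_∈ A) xs × vsum xs ≡ g

  Covers : ℕ → Subset n → Set
  Covers k A = ∀ g → ∃ λ k' → 1 ≤ k' × k' ≤ k × InSumset k' A g

  IsWidth : Subset n → ℕ → Set
  IsWidth A w = 1 ≤ w × Covers w A × (∀ k → 1 ≤ k → Covers k A → w ≤ k)

module Submission where

-- The engine is Kemperman's theorem for abelian groups: whenever c ∈ P + Q,
--   |P| + |Q| ≤ |P + Q| + r(c),   r(c) = #{x ∈ P : c - x ∈ Q},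
-- proved by induction on |Q| with Dyson's e-transform.  With 0 ∈ A the sumsets kA increase;
-- Kemperman applied to A + (k+1)A at some c ∈ (k+2)A ∖ (k+1)A gives the growth step
-- |(k+2)A| ≥ |kA| + |A|.  Such a c exists as long as (k+1)A ≠ G, since a stable (k+1)A
-- is a subgroup containing A.  Adding up growth steps, |jA| + |(j+1)A| > (j+1)|A|, and the
-- pigeonhole bound |iA| + |jA| ≤ n (valid when (i+j)A ≠ G) then shows that 2n ≤ (j+2)|A|
-- forces (j+1)A = G.  For 0 ∉ A this is applied to A ∪ {0}, and the zeros are dropped.

open import Defs
open import Algebra.Bundles using (AbelianGroup)
open import Algebra.Structures using (IsAbelianGroup)
import Algebra.Properties.CommutativeMonoid.Sum as Sum
open import Data.Bool using (Bool; true; false; _∧_; _∨_; not; T)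
open import Data.Bool.Properties using (T-∧; T-∨; T-≡; T?; ∧-comm)
open import Data.Fin using (Fin; zero; suc; _≟_)
open import Data.Fin.Permutation using (permutation)
open import Data.Fin.Properties using (any?; all?; nonZeroIndex)
open import Data.Fin.Subset using (Subset; _∈_; _∉_; _⊆_; ∣_∣; Nonempty)
open import Data.Fin.Subset.Properties using (_∈?_)
open import Data.Nat
  using (ℕ; zero; suc; _+_; _*_; _∸_; _/_; _%_; _≤_; _<_; _≤?_; _≤′_; ≤′-refl; ≤′-step;
         z≤n; s≤s; s≤s⁻¹; >-nonZero⁻¹)
open import Data.Nat.DivMod using (m≡m%n+[m/n]*n; m%n<n)
open import Data.Nat.Induction using (<-rec)
open import Data.Nat.Properties
  using (≤-refl; ≤-reflexive; ≤-trans; ≤-antisym; ≤-pred; <⇒≤; <⇒≱; ≮⇒≥; <-irrefl; ≤⇒≤′;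
         m≤m+n; m≤n+m; m<m+n; m≤n⇒m≤1+n; +-comm; +-assoc; +-suc; +-identityʳ; *-identityˡ;
         +-mono-≤; +-monoˡ-≤; +-monoʳ-≤; +-monoʳ-<; *-monoʳ-≤; +-cancelʳ-≤;
         +-0-commutativeMonoid; anyUpTo?; module ≤-Reasoning)
open import Data.Product using (∃; _×_; _,_; proj₁; proj₂; map₂)
open import Data.Sum using (_⊎_; inj₁; inj₂)
open import Data.Unit using (tt)
open import Data.Vec using ([]; _∷_; lookup; tabulate)
open import Data.Vec.Properties using ([]=⇒lookup; lookup⇒[]=; lookup∘tabulate)
open import Data.Vec.Relation.Unary.All using ([]; _∷_)
open import Function using (_∘_; const; Equivalence)
open import Level using (0ℓ)
open import Relation.Binary.PropositionalEquality
open import Relation.Nullary using (¬_; Dec; yes; no; contradiction; ¬?; _×-dec_)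
open import Relation.Nullary.Decidable using (⌊_⌋; toWitness; fromWitness; map′)

ceilDiv-spec : ∀ m a → 1 ≤ a → m ≤ ceilDiv m a * a
ceilDiv-spec m (suc b) _ = +-cancelʳ-≤ b m (q * suc b) (begin
  m + b                         ≡⟨ m≡m%n+[m/n]*n (m + b) (suc b) ⟩
  (m + b) % suc b + q * suc b   ≤⟨ +-monoˡ-≤ (q * suc b) (s≤s⁻¹ (m%n<n (m + b) (suc b))) ⟩
  b + q * suc b                 ≡⟨ +-comm b (q * suc b) ⟩
  q * suc b + b                 ∎)
  where
  open ≤-Reasoning
  q = (m + b) / suc b

least-witness : (P : ℕ → Set) → (∀ k → Dec (P k)) → ∀ B → P B →
                ∃ λ w → w ≤ B × P w × (∀ k → P k → w ≤ k)
least-witness P P? = <-rec (λ B → P B → ∃ λ w → w ≤ B × P w × (∀ k → P k → w ≤ k)) step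
  where
  step : ∀ B → (∀ {k} → k < B → P k → ∃ λ w → w ≤ k × P w × (∀ k → P k → w ≤ k)) →
         P B → ∃ λ w → w ≤ B × P w × (∀ k → P k → w ≤ k)
  step B smaller PB with anyUpTo? P? B
  ... | no  none = B , ≤-refl , PB , λ k Pk → ≮⇒≥ (λ k<B → none (k , k<B , Pk))
  ... | yes (k , k<B , Pk) with smaller k<B Pk
  ...   | w , w≤k , Pw , least = w , ≤-trans w≤k (<⇒≤ k<B) , Pw , least

at-least-two : ∀ {n} c a → 1 ≤ n → a ≤ n → 2 * n ≤ c * a → ∃ λ j → c ≡ 2 + j
at-least-two (suc (suc j)) a 1≤n a≤n bound = j , refl
at-least-two {n} zero a 1≤n a≤n bound = contradiction (≤-trans (≤-trans 1≤n (m≤m+n n _)) bound) λ ()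
at-least-two {n} 1 a 1≤n a≤n bound = contradiction (≤-trans bound 1·a≤n) (<⇒≱ n<2n)
  where
  1·a≤n : 1 * a ≤ n
  1·a≤n = ≤-trans (≤-reflexive (*-identityˡ a)) a≤n
  n<2n : n < 2 * n
  n<2n = m<m+n n (subst (1 ≤_) (sym (+-identityʳ n)) 1≤n)

private variable n : ℕ

infix 4 _∈ᵢ_ _∉ᵢ_ _⊆ᵢ_
infixr 7 _∩ᵢ_ _∖ᵢ_
infixr 6 _∪ᵢ_

Indicator : ℕ → Set
Indicator n = Fin n → Bool

_∈ᵢ_ : Fin n → Indicator n → Set
x ∈ᵢ P = T (P x)

_∉ᵢ_ : Fin n → Indicator n → Set
x ∉ᵢ P = ¬ x ∈ᵢ P

_⊆ᵢ_ : Indicator n → Indicator n → Set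
P ⊆ᵢ Q = ∀ x → x ∈ᵢ P → x ∈ᵢ Q

_∪ᵢ_ _∩ᵢ_ _∖ᵢ_ : Indicator n → Indicator n → Indicator n
(P ∪ᵢ Q) x = P x ∨ Q x
(P ∩ᵢ Q) x = P x ∧ Q x
(P ∖ᵢ Q) x = P x ∧ not (Q x)

module _ {a b : Bool} where
  open Equivalence

  ∧-intro : T a → T b → T (a ∧ b)
  ∧-intro p q = from T-∧ (p , q)

  ∧-fst : T (a ∧ b) → T a
  ∧-fst = proj₁ ∘ to T-∧

  ∧-snd : T (a ∧ b) → T b
  ∧-snd = proj₂ ∘ to (T-∧ {a})

  ∨-injˡ : T a → T (a ∨ b)
  ∨-injˡ = from T-∨ ∘ inj₁

  ∨-injʳ : T b → T (a ∨ b)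
  ∨-injʳ = from (T-∨ {a}) ∘ inj₂

  ∨-case : T (a ∨ b) → T a ⊎ T b
  ∨-case = to T-∨

not-intro : ∀ {a} → ¬ T a → T (not a)
not-intro {false} _ = tt
not-intro {true}  ¬t = ¬t tt

not-elim : ∀ {a} → T (not a) → ¬ T a
not-elim {false} _ ()

toℕ : Bool → ℕ
toℕ true  = 1
toℕ false = 0

open Sum +-0-commutativeMonoid using (sum; sum-cong-≗; ∑-distrib-+; sum-permute)

size : Indicator n → ℕ
size P = sum (toℕ ∘ P)

size≤n : (P : Indicator n) → size P ≤ n
size≤n {zero}  P = z≤n
size≤n {suc n} P = +-mono-≤ (bound (P zero)) (size≤n (P ∘ suc))
  where
  bound : ∀ b → toℕ b ≤ 1
  bound true  = s≤s z≤n
  bound false = z≤n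

size-mono : (P Q : Indicator n) → P ⊆ᵢ Q → size P ≤ size Q
size-mono {zero}  P Q P⊆Q = z≤n
size-mono {suc n} P Q P⊆Q =
  +-mono-≤ (head (P zero) (Q zero) (P⊆Q zero)) (size-mono (P ∘ suc) (Q ∘ suc) (P⊆Q ∘ suc))
  where
  head : ∀ a b → (T a → T b) → toℕ a ≤ toℕ b
  head false b   _ = z≤n
  head true true _ = s≤s z≤n
  head true false h = contradiction tt h

size-cong : (P Q : Indicator n) → (∀ x → P x ≡ Q x) → size P ≡ size Q
size-cong P Q eq = sum-cong-≗ (cong toℕ ∘ eq)

size-∪-∩ : (P Q : Indicator n) → size (P ∪ᵢ Q) + size (P ∩ᵢ Q) ≡ size P + size Q
size-∪-∩ P Q = begin
  size (P ∪ᵢ Q) + size (P ∩ᵢ Q)            ≡⟨ ∑-distrib-+ (toℕ ∘ (P ∪ᵢ Q)) (toℕ ∘ (P ∩ᵢ Q)) ⟨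
  sum (λ x → toℕ (P x ∨ Q x) + toℕ (P x ∧ Q x)) ≡⟨ sum-cong-≗ (λ x → pointwise (P x) (Q x)) ⟩
  sum (λ x → toℕ (P x) + toℕ (Q x))         ≡⟨ ∑-distrib-+ (toℕ ∘ P) (toℕ ∘ Q) ⟩
  size P + size Q                           ∎
  where
  open ≡-Reasoning
  pointwise : ∀ a b → toℕ (a ∨ b) + toℕ (a ∧ b) ≡ toℕ a + toℕ b
  pointwise true  true  = refl
  pointwise true  false = refl
  pointwise false b     = +-identityʳ (toℕ b)

size-split : (P Q : Indicator n) → size P ≡ size (P ∩ᵢ Q) + size (P ∖ᵢ Q)
size-split P Q = trans (sum-cong-≗ (λ x → pointwise (P x) (Q x)))
                       (∑-distrib-+ (toℕ ∘ (P ∩ᵢ Q)) (toℕ ∘ (P ∖ᵢ Q)))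
  where
  pointwise : ∀ a b → toℕ a ≡ toℕ (a ∧ b) + toℕ (a ∧ not b)
  pointwise true  true  = refl
  pointwise true  false = refl
  pointwise false b     = refl

size-pos : (P : Indicator n) (x : Fin n) → x ∈ᵢ P → 1 ≤ size P
size-pos P zero    x∈P with P zero
... | true = s≤s z≤n
size-pos P (suc x) x∈P = ≤-trans (size-pos (P ∘ suc) x x∈P) (m≤n+m _ (toℕ (P zero)))

size-disjoint : (P Q : Indicator n) → (∀ x → x ∈ᵢ P → x ∉ᵢ Q) → size P + size Q ≤ n
size-disjoint {n} P Q disj = begin
  size P + size Q                ≡⟨ size-∪-∩ P Q ⟨
  size (P ∪ᵢ Q) + size (P ∩ᵢ Q) ≤⟨ +-mono-≤ (size≤n (P ∪ᵢ Q)) (size-mono _ (λ _ → false) none) ⟩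
  n + size {n} (λ _ → false)    ≡⟨ cong (n +_) (sum-replicate-zero n) ⟩
  n + 0                         ≡⟨ +-identityʳ n ⟩
  n                             ∎
  where
  open ≤-Reasoning
  open Sum +-0-commutativeMonoid using (sum-replicate-zero)
  none : (P ∩ᵢ Q) ⊆ᵢ (λ _ → false)
  none x x∈P∩Q = disj x (∧-fst x∈P∩Q) (∧-snd {P x} x∈P∩Q)

size-strict : (P Q : Indicator n) → P ⊆ᵢ Q → (x : Fin n) → x ∈ᵢ Q → x ∉ᵢ P →
              suc (size P) ≤ size Q
size-strict P Q P⊆Q x x∈Q x∉P = begin
  suc (size P)                       ≡⟨ +-comm 1 (size P) ⟩
  size P + 1                         ≤⟨ +-mono-≤ (size-mono P (Q ∩ᵢ P) (λ y y∈P → ∧-intro (P⊆Q y y∈P) y∈P))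
                                                 (size-pos (Q ∖ᵢ P) x (∧-intro x∈Q (not-intro x∉P))) ⟩
  size (Q ∩ᵢ P) + size (Q ∖ᵢ P)      ≡⟨ size-split Q P ⟨
  size Q                             ∎
  where open ≤-Reasoning

size-⊆-≥ : (P Q : Indicator n) → P ⊆ᵢ Q → size Q ≤ size P → Q ⊆ᵢ P
size-⊆-≥ P Q P⊆Q Q≤P x x∈Q with T? (P x)
... | yes x∈P = x∈P
... | no  x∉P = contradiction (≤-trans (size-strict P Q P⊆Q x x∈Q x∉P) Q≤P) (<-irrefl refl)

size-permute : (P : Indicator n) (σ τ : Fin n → Fin n) →
               (∀ x → σ (τ x) ≡ x) → (∀ x → τ (σ x) ≡ x) → size (P ∘ σ) ≡ size P
size-permute P σ τ στ τσ = sym (sum-permute (toℕ ∘ P) (permutation σ τ στ τσ))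

module FiniteAbelianGroup {n : ℕ} (op : Fin n → Fin n → Fin n) (unit : Fin n) (inverse : Fin n → Fin n)
                          (isAbelianGroup : IsAbelianGroup _≡_ op unit inverse) where

  abelianGroup : AbelianGroup 0ℓ 0ℓ
  abelianGroup = record { isAbelianGroup = isAbelianGroup }

  open AbelianGroup abelianGroup
    using (_∙_; ε; _⁻¹; _-_; assoc; comm; identityˡ; identityʳ; commutativeSemigroup)
  open import Algebra.Properties.AbelianGroup abelianGroup
    using (//-rightDividesˡ; //-rightDividesʳ; ⁻¹-anti-homo‿-; ε⁻¹≈ε)
  open import Algebra.Properties.CommutativeSemigroup commutativeSemigroup
    using (x∙yz≈y∙xz; xy∙z≈xz∙y)

  ∙-diff : ∀ y g → y ∙ (g - y) ≡ g
  ∙-diff y g = trans (comm y (g - y)) (//-rightDividesˡ y g)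

  diff-∙ : ∀ y z → (y ∙ z) - y ≡ z
  diff-∙ y z = trans (cong (_- y) (comm y z)) (//-rightDividesʳ y z)

  reflect-involutive : ∀ c x → c - (c - x) ≡ x
  reflect-involutive c x = begin
    c ∙ (c - x) ⁻¹   ≡⟨ cong (c ∙_) (⁻¹-anti-homo‿- c x) ⟩
    c ∙ (x - c)      ≡⟨ ∙-diff c x ⟩
    x                ∎
    where open ≡-Reasoning

  size-translate : (P : Indicator n) (d : Fin n) → size (P ∘ (_∙ d)) ≡ size P
  size-translate P d = size-permute P (_∙ d) (_- d) (//-rightDividesˡ d) (//-rightDividesʳ d)

  size-reflect : (P : Indicator n) (c : Fin n) → size (P ∘ (c -_)) ≡ size P
  size-reflect P c = size-permute P (c -_) (c -_) (reflect-involutive c) (reflect-involutive c)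

  -- If P + s ⊆ P then P + s = P (P is finite), hence also P - s ⊆ P.
  translation-closed⁻¹ : (P : Indicator n) (s : Fin n) → (∀ y → y ∈ᵢ P → (y ∙ s) ∈ᵢ P) →
                         ∀ y → y ∈ᵢ P → (y - s) ∈ᵢ P
  translation-closed⁻¹ P s closed =
    size-⊆-≥ (P ∘ (_- s)) P shifted (≤-reflexive (sym (size-translate P (s ⁻¹))))
    where
    shifted : (P ∘ (_- s)) ⊆ᵢ P
    shifted z z∈ = subst (_∈ᵢ P) (//-rightDividesˡ s z) (closed (z - s) z∈)

  _⊕_ : Indicator n → Indicator n → Indicator n
  (P ⊕ Q) g = ⌊ any? (λ y → T? (P y ∧ Q (g - y))) ⌋

  ⊕-intro : (P Q : Indicator n) {y z g : Fin n} → y ∈ᵢ P → z ∈ᵢ Q → y ∙ z ≡ g → g ∈ᵢ (P ⊕ Q)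
  ⊕-intro P Q {y} {z} y∈P z∈Q refl =
    fromWitness (y , ∧-intro y∈P (subst (_∈ᵢ Q) (sym (diff-∙ y z)) z∈Q))

  ⊕-elim : (P Q : Indicator n) {g : Fin n} → g ∈ᵢ (P ⊕ Q) → ∃ λ y → y ∈ᵢ P × (g - y) ∈ᵢ Q
  ⊕-elim P Q g∈ with toWitness g∈
  ... | y , t = y , ∧-fst t , ∧-snd {P y} t

  rep : Indicator n → Indicator n → Fin n → ℕ
  rep P Q c = size (P ∩ᵢ (Q ∘ (c -_)))

  module DysonTransform (P Q : Indicator n) (d : Fin n) where

    P' Q' : Indicator n
    P' = P ∪ᵢ (Q ∘ (_- d))
    Q' = Q ∩ᵢ (P ∘ (_∙ d))

    size-preserved : size P' + size Q' ≡ size P + size Q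
    size-preserved = begin
      size P' + size Q'                     ≡⟨ cong (size P' +_) size-Q' ⟨
      size P' + size (P ∩ᵢ (Q ∘ (_- d)))    ≡⟨ size-∪-∩ P (Q ∘ (_- d)) ⟩
      size P + size (Q ∘ (_- d))            ≡⟨ cong (size P +_) (size-translate Q (d ⁻¹)) ⟩
      size P + size Q                       ∎
      where
      open ≡-Reasoning
      size-Q' : size (P ∩ᵢ (Q ∘ (_- d))) ≡ size Q'
      size-Q' = trans (sym (size-translate (P ∩ᵢ (Q ∘ (_- d))) d))
                       (size-cong _ Q' (λ z → trans (cong (λ u → P (z ∙ d) ∧ Q u) (//-rightDividesʳ d z))
                                                    (∧-comm (P (z ∙ d)) (Q z))))

    -- A sum y + z with y ∈ Q + d and z ∈ Q' is rearranged as (z + d) + (y - d) ∈ P + Q.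
    sumset-shrinks : (P' ⊕ Q') ⊆ᵢ (P ⊕ Q)
    sumset-shrinks g g∈ with ⊕-elim P' Q' g∈
    ... | y , y∈P' , g-y∈Q' with ∨-case {P y} y∈P'
    ...   | inj₁ y∈P   = ⊕-intro P Q y∈P (∧-fst g-y∈Q') (∙-diff y g)
    ...   | inj₂ y-d∈Q = ⊕-intro P Q (∧-snd {Q (g - y)} g-y∈Q') y-d∈Q swap
      where
      swap : ((g - y) ∙ d) ∙ (y - d) ≡ g
      swap = begin
        ((g - y) ∙ d) ∙ (y - d) ≡⟨ assoc (g - y) d (y - d) ⟩
        (g - y) ∙ (d ∙ (y - d)) ≡⟨ cong ((g - y) ∙_) (∙-diff d y) ⟩
        (g - y) ∙ y             ≡⟨ //-rightDividesˡ y g ⟩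
        g                       ∎
        where open ≡-Reasoning

    -- Split the representations c = x + (c - x) for (P', Q') by whether x ∈ P.  Those with
    -- x ∈ P (the set S) are representations for (P, Q); the reflection y ↦ (c + d) - y maps
    -- those with x ∉ P injectively to representations for (P, Q) outside S.
    rep-shrinks : ∀ c → rep P' Q' c ≤ rep P Q c
    rep-shrinks c = begin
      size R'                         ≡⟨ size-split R' P ⟩
      size S + size (R' ∖ᵢ P)          ≤⟨ +-mono-≤ (size-mono S (R ∩ᵢ S) S⊆R∩S) new-bound ⟩
      size (R ∩ᵢ S) + size (R ∖ᵢ S)    ≡⟨ size-split R S ⟨
      size R                          ∎
      where
      open ≤-Reasoning
      R R' S : Indicator n
      R  = P  ∩ᵢ (Q  ∘ (c -_))
      R' = P' ∩ᵢ (Q' ∘ (c -_))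
      S  = R' ∩ᵢ P

      S⊆R∩S : S ⊆ᵢ (R ∩ᵢ S)
      S⊆R∩S x x∈S = ∧-intro (∧-intro (∧-snd {R' x} x∈S) (∧-fst (∧-snd {P' x} (∧-fst x∈S)))) x∈S

      ρ : Fin n → Fin n
      ρ = (c ∙ d) -_

      shift : ∀ y → (c - y) ∙ d ≡ ρ y
      shift y = xy∙z≈xz∙y c (y ⁻¹) d

      reflected : ((R' ∖ᵢ P) ∘ ρ) ⊆ᵢ (R ∖ᵢ S)
      reflected y t = ∧-intro (∧-intro y∈P c-y∈Q) (not-intro y∉S)
        where
        x : Fin n
        x = ρ y
        x∈P' : x ∈ᵢ P'
        x∈P' = ∧-fst (∧-fst t)
        c-x∈Q' : (c - x) ∈ᵢ Q'
        c-x∈Q' = ∧-snd {P' x} (∧-fst t)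
        x∉P : x ∉ᵢ P
        x∉P = not-elim (∧-snd {R' x} t)
        y∈P : y ∈ᵢ P
        y∈P = subst (_∈ᵢ P) (trans (shift x) (reflect-involutive (c ∙ d) y)) (∧-snd {Q (c - x)} c-x∈Q')
        c-y∈Q : (c - y) ∈ᵢ Q
        c-y∈Q with ∨-case {P x} x∈P'
        ... | inj₁ x∈P   = contradiction x∈P x∉P
        ... | inj₂ x-d∈Q = subst (_∈ᵢ Q) x-d≡c-y x-d∈Q
          where
          x-d≡c-y : x - d ≡ c - y
          x-d≡c-y = trans (cong (_- d) (sym (shift y))) (//-rightDividesʳ d (c - y))
        y∉S : y ∉ᵢ S
        y∉S y∈S = x∉P (subst (_∈ᵢ P) (shift y) (∧-snd {Q (c - y)} (∧-snd {P' y} (∧-fst y∈S))))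

      new-bound : size (R' ∖ᵢ P) ≤ size (R ∖ᵢ S)
      new-bound = begin
        size (R' ∖ᵢ P)         ≡⟨ size-reflect (R' ∖ᵢ P) (c ∙ d) ⟨
        size ((R' ∖ᵢ P) ∘ ρ)   ≤⟨ size-mono _ _ reflected ⟩
        size (R ∖ᵢ S)          ∎

  -- p - ((c - x) - (c - p)) = x: the shift carrying the witness p to another representation.
  difference-cancel : ∀ p c x → p - ((c - x) - (c - p)) ≡ x
  difference-cancel p c x = begin
    p ∙ ((c - x) - (c - p)) ⁻¹   ≡⟨ cong (p ∙_) (⁻¹-anti-homo‿- (c - x) (c - p)) ⟩
    p ∙ ((c - p) - (c - x))      ≡⟨ assoc p (c - p) ((c - x) ⁻¹) ⟨
    (p ∙ (c - p)) - (c - x)      ≡⟨ cong (_- (c - x)) (∙-diff p c) ⟩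
    c - (c - x)                  ≡⟨ reflect-involutive c x ⟩
    x                            ∎
    where open ≡-Reasoning

  -- Kemperman's inequality when P + (Q - q₀) ⊆ P for q₀ = c - p: then P + q₀ ⊆ P + Q,
  -- and P is invariant under all of Q - q₀, so every q ∈ Q yields a representation of c.
  kemperman-closed : (P Q : Indicator n) (c p : Fin n) → p ∈ᵢ P → (c - p) ∈ᵢ Q →
                     (∀ e q → e ∈ᵢ P → q ∈ᵢ Q → (q ∙ (e - (c - p))) ∈ᵢ P) →
                     size P + size Q ≤ size (P ⊕ Q) + rep P Q c
  kemperman-closed P Q c p p∈P q₀∈Q closed = +-mono-≤ P-bound Q-bound
    where
    q₀ : Fin n
    q₀ = c - p

    P-bound : size P ≤ size (P ⊕ Q)
    P-bound = begin
      size P               ≡⟨ size-translate P (q₀ ⁻¹) ⟨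
      size (P ∘ (_- q₀))   ≤⟨ size-mono _ _ (λ x x-q₀∈P → ⊕-intro P Q x-q₀∈P q₀∈Q
                                                                    (//-rightDividesˡ q₀ x)) ⟩
      size (P ⊕ Q)         ∎
      where open ≤-Reasoning

    represents : ∀ x → (c - x) ∈ᵢ Q → x ∈ᵢ P
    represents x q∈Q = subst (_∈ᵢ P) (difference-cancel p c x)
                             (translation-closed⁻¹ P (q - q₀) closed-by-shift p p∈P)
      where
      q : Fin n
      q = c - x
      closed-by-shift : ∀ y → y ∈ᵢ P → (y ∙ (q - q₀)) ∈ᵢ P
      closed-by-shift y y∈P = subst (_∈ᵢ P) (x∙yz≈y∙xz q y (q₀ ⁻¹)) (closed y q y∈P q∈Q)

    Q-bound : size Q ≤ rep P Q c
    Q-bound = begin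
      size Q               ≡⟨ size-reflect Q c ⟨
      size (Q ∘ (c -_))    ≤⟨ size-mono _ _ (λ x t → ∧-intro (represents x t) t) ⟩
      rep P Q c            ∎
      where open ≤-Reasoning

  -- While some e ∈ P, q ∈ Q escape, i.e. q + (e - q₀) ∉ P,
  -- the Dyson transform with d = e - q₀ keeps the witness, preserves |P| + |Q|, does not
  -- increase |P + Q| or r(c), and strictly shrinks Q; otherwise kemperman-closed applies.
  kemperman : (P Q : Indicator n) (c p : Fin n) → p ∈ᵢ P → (c - p) ∈ᵢ Q →
              size P + size Q ≤ size (P ⊕ Q) + rep P Q c
  kemperman P Q c p = bounded (size Q) P Q ≤-refl
    where
    q₀ : Fin n
    q₀ = c - p

    bounded : ∀ k (P Q : Indicator n) → size Q ≤ k → p ∈ᵢ P → q₀ ∈ᵢ Q →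
              size P + size Q ≤ size (P ⊕ Q) + rep P Q c
    bounded zero P Q |Q|≤0 p∈P q₀∈Q = contradiction (≤-trans (size-pos Q q₀ q₀∈Q) |Q|≤0) λ ()
    bounded (suc k) P Q |Q|≤k p∈P q₀∈Q
      with any? (λ e → any? (λ q → T? (P e) ×-dec T? (Q q) ×-dec ¬? (T? (P (q ∙ (e - q₀))))))
    ... | no no-escape = kemperman-closed P Q c p p∈P q₀∈Q closed
      where
      closed : ∀ e q → e ∈ᵢ P → q ∈ᵢ Q → (q ∙ (e - q₀)) ∈ᵢ P
      closed e q e∈P q∈Q with T? (P (q ∙ (e - q₀)))
      ... | yes inside = inside
      ... | no  outside = contradiction (e , q , e∈P , q∈Q , outside) no-escape
    ... | yes (e , q , e∈P , q∈Q , escapes) = begin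
      size P + size Q                ≡⟨ size-preserved ⟨
      size P' + size Q'              ≤⟨ bounded k P' Q' |Q'|≤k (∨-injˡ p∈P) q₀∈Q' ⟩
      size (P' ⊕ Q') + rep P' Q' c   ≤⟨ +-mono-≤ (size-mono _ _ sumset-shrinks) (rep-shrinks c) ⟩
      size (P ⊕ Q) + rep P Q c       ∎
      where
      open ≤-Reasoning
      open DysonTransform P Q (e - q₀)
      q₀∈Q' : q₀ ∈ᵢ Q'
      q₀∈Q' = ∧-intro q₀∈Q (subst (_∈ᵢ P) (sym (∙-diff q₀ e)) e∈P)
      |Q'|≤k : size Q' ≤ k
      |Q'|≤k = ≤-pred (≤-trans (size-strict Q' Q (λ _ → ∧-fst) q q∈Q (escapes ∘ ∧-snd {Q q})) |Q|≤k)

  zero-set : Indicator n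
  zero-set g = ⌊ g ≟ ε ⌋

  infix 5 _·_
  _·_ : ℕ → Indicator n → Indicator n
  zero  · A = zero-set
  suc k · A = A ⊕ (k · A)

  ε∈0·A : (A : Indicator n) → ε ∈ᵢ (0 · A)
  ε∈0·A A = fromWitness refl

  0·A⊆ε : (A : Indicator n) {g : Fin n} → g ∈ᵢ (0 · A) → g ≡ ε
  0·A⊆ε A = toWitness

  A⊆1·A : (A : Indicator n) → A ⊆ᵢ (1 · A)
  A⊆1·A A g g∈A = ⊕-intro A (0 · A) g∈A (ε∈0·A A) (identityʳ g)

  ·-add : (A : Indicator n) (i j : ℕ) {x y : Fin n} → x ∈ᵢ (i · A) → y ∈ᵢ (j · A) →
          (x ∙ y) ∈ᵢ ((i + j) · A)
  ·-add A zero    j {x} {y} x∈ y∈ = subst (λ u → (u ∙ y) ∈ᵢ (j · A)) (sym (0·A⊆ε A x∈))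
                                          (subst (_∈ᵢ (j · A)) (sym (identityˡ y)) y∈)
  ·-add A (suc i) j {x} {y} x∈ y∈ with ⊕-elim A (i · A) x∈
  ... | a , a∈A , x-a∈ = ⊕-intro A ((i + j) · A) a∈A (·-add A i j x-a∈ y∈) regroup
    where
    regroup : a ∙ ((x - a) ∙ y) ≡ x ∙ y
    regroup = trans (sym (assoc a (x - a) y)) (cong (_∙ y) (∙-diff a x))

  -- If some g ∉ (i + j)A, then iA and g - jA are disjoint, so |iA| + |jA| ≤ n.
  pigeonhole : (A : Indicator n) (i j : ℕ) {g : Fin n} → g ∉ᵢ ((i + j) · A) →
               size (i · A) + size (j · A) ≤ n
  pigeonhole A i j {g} g∉ = begin
    size (i · A) + size (j · A)               ≡⟨ cong (size (i · A) +_) (size-reflect (j · A) g) ⟨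
    size (i · A) + size ((j · A) ∘ (g -_))    ≤⟨ size-disjoint (i · A) _ disjoint ⟩
    n                                         ∎
    where
    open ≤-Reasoning
    disjoint : ∀ x → x ∈ᵢ (i · A) → (g - x) ∉ᵢ (j · A)
    disjoint x x∈ g-x∈ = g∉ (subst (_∈ᵢ ((i + j) · A)) (∙-diff x g) (·-add A i j x∈ g-x∈))

  drop-zeros : (A : Indicator n) → ∀ k {g} → g ∈ᵢ k · (A ∪ᵢ zero-set) → ∃ λ k′ → k′ ≤ k × g ∈ᵢ k′ · A
  drop-zeros A zero    g∈ = zero , z≤n , g∈
  drop-zeros A (suc k) {g} g∈ with ⊕-elim (A ∪ᵢ zero-set) (k · (A ∪ᵢ zero-set)) g∈
  ... | y , y∈ , g-y∈ with drop-zeros A k g-y∈ | ∨-case {A y} y∈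
  ...   | k′ , k′≤k , g-y∈′ | inj₁ y∈A = suc k′ , s≤s k′≤k , ⊕-intro A (k′ · A) y∈A g-y∈′ (∙-diff y g)
  ...   | k′ , k′≤k , g-y∈′ | inj₂ y≡ε = k′ , m≤n⇒m≤1+n k′≤k , subst (_∈ᵢ k′ · A) g-ε≡g g-y∈′
    where
    g-ε≡g : g - y ≡ g
    g-ε≡g = begin
      g ∙ y ⁻¹   ≡⟨ cong (λ u → g ∙ u ⁻¹) (toWitness y≡ε) ⟩
      g ∙ ε ⁻¹   ≡⟨ cong (g ∙_) ε⁻¹≈ε ⟩
      g ∙ ε      ≡⟨ identityʳ g ⟩
      g          ∎
      where open ≡-Reasoning

  IsSubgroupᵢ : Indicator n → Set
  IsSubgroupᵢ S = ε ∈ᵢ S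
                × (∀ x y → x ∈ᵢ S → y ∈ᵢ S → (x ∙ y) ∈ᵢ S)
                × (∀ x → x ∈ᵢ S → (x ⁻¹) ∈ᵢ S)

  Generates : Indicator n → Set
  Generates A = ∀ S → IsSubgroupᵢ S → A ⊆ᵢ S → ∀ x → x ∈ᵢ S

  -- Throughout, ε ∈ A, so that the sumsets kA increase with k.
  module SumsetsWithZero (A : Indicator n) (ε∈A : ε ∈ᵢ A) where

    ·-step : ∀ k → (k · A) ⊆ᵢ (suc k · A)
    ·-step k g g∈ = ⊕-intro A (k · A) ε∈A g∈ (identityˡ g)

    ·-mono : ∀ k j → k ≤ j → (k · A) ⊆ᵢ (j · A)
    ·-mono k j k≤j g g∈ = go (≤⇒≤′ k≤j)
      where
      go : ∀ {j} → k ≤′ j → g ∈ᵢ (j · A)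
      go ≤′-refl                = g∈
      go {suc j} (≤′-step k≤′j) = ·-step j g (go k≤′j)

    -- Growth: if c ∈ (k+2)A ∖ (k+1)A then |A| + |kA| ≤ |(k+2)A|.  Apply Kemperman to
    -- A + (k+1)A at c: every representation c = x + y has y ∈ (k+1)A ∖ kA.
    growth : ∀ k {c} → c ∈ᵢ (2 + k) · A → c ∉ᵢ (1 + k) · A → size A + size (k · A) ≤ size ((2 + k) · A)
    growth k {c} c∈ c∉ with ⊕-elim A ((1 + k) · A) c∈
    ... | p , p∈A , c-p∈ = +-cancelʳ-≤ (size New) _ _ (begin
      size A + size (k · A) + size New      ≡⟨ +-assoc (size A) _ _ ⟩
      size A + (size (k · A) + size New)    ≡⟨ cong (size A +_) layers ⟨
      size A + size E                       ≤⟨ kemperman A E c p p∈A c-p∈ ⟩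
      size ((2 + k) · A) + rep A E c        ≤⟨ +-monoʳ-≤ _ rep≤new ⟩
      size ((2 + k) · A) + size New         ∎)
      where
      open ≤-Reasoning
      E New : Indicator n
      E   = (1 + k) · A
      New = E ∖ᵢ (k · A)

      layers : size E ≡ size (k · A) + size New
      layers = trans (size-split E (k · A))
                     (cong (_+ size New) (≤-antisym (size-mono _ _ (λ x t → ∧-snd {E x} t))
                                                    (size-mono _ _ (λ x t → ∧-intro (·-step k x t) t))))

      new : ((A ∩ᵢ (E ∘ (c -_))) ∘ (c -_)) ⊆ᵢ New
      new y t = ∧-intro y∈E (not-intro y∉kA)
        where
        y∈E : y ∈ᵢ E
        y∈E = subst (_∈ᵢ E) (reflect-involutive c y) (∧-snd {A (c - y)} t)
        y∉kA : y ∉ᵢ (k · A)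
        y∉kA y∈kA = c∉ (⊕-intro A (k · A) (∧-fst t) y∈kA (//-rightDividesˡ y c))

      rep≤new : rep A E c ≤ size New
      rep≤new = ≤-trans (≤-reflexive (sym (size-reflect (A ∩ᵢ (E ∘ (c -_))) c))) (size-mono _ _ new)

    stable⇒subgroup : ∀ k → ((2 + k) · A) ⊆ᵢ ((1 + k) · A) → IsSubgroupᵢ ((1 + k) · A)
    stable⇒subgroup k stable = ε∈S , closed-∙ , closed-⁻¹
      where
      S : Indicator n
      S = (1 + k) · A

      ε∈S : ε ∈ᵢ S
      ε∈S = ·-mono 0 (1 + k) z≤n ε (ε∈0·A A)

      absorbs : ∀ j {x y} → x ∈ᵢ S → y ∈ᵢ (j · A) → (x ∙ y) ∈ᵢ S
      absorbs zero    {x} x∈ y∈ =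
        subst (_∈ᵢ S) (trans (sym (identityʳ x)) (cong (x ∙_) (sym (0·A⊆ε A y∈)))) x∈
      absorbs (suc j) {x} {y} x∈ y∈ with ⊕-elim A (j · A) y∈
      ... | a , a∈A , y-a∈ =
        subst (_∈ᵢ S) regroup (stable _ (⊕-intro A S a∈A (absorbs j x∈ y-a∈) refl))
        where
        regroup : a ∙ (x ∙ (y - a)) ≡ x ∙ y
        regroup = trans (x∙yz≈y∙xz a x (y - a)) (cong (x ∙_) (∙-diff a y))

      closed-∙ : ∀ x y → x ∈ᵢ S → y ∈ᵢ S → (x ∙ y) ∈ᵢ S
      closed-∙ x y x∈ y∈ = absorbs (1 + k) x∈ y∈

      closed-⁻¹ : ∀ x → x ∈ᵢ S → (x ⁻¹) ∈ᵢ S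
      closed-⁻¹ x x∈ = subst (_∈ᵢ S) (identityˡ (x ⁻¹))
                             (translation-closed⁻¹ S x (λ y y∈ → closed-∙ y x y∈ x∈) ε ε∈S)

    new-element : Generates A → ∀ k {g} → g ∉ᵢ (1 + k) · A →
                  ∃ λ c → c ∈ᵢ (2 + k) · A × c ∉ᵢ (1 + k) · A
    new-element generates k {g} g∉
      with any? (λ c → T? (((2 + k) · A) c) ×-dec ¬? (T? (((1 + k) · A) c)))
    ... | yes found = found
    ... | no  none  = contradiction (generates _ (stable⇒subgroup k stable) A⊆S g) g∉
      where
      A⊆S : A ⊆ᵢ ((1 + k) · A)
      A⊆S x x∈A = ·-mono 1 (1 + k) (s≤s z≤n) x (A⊆1·A A x x∈A)
      stable : ((2 + k) · A) ⊆ᵢ ((1 + k) · A)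
      stable c c∈ with T? (((1 + k) · A) c)
      ... | yes c∈′ = c∈′
      ... | no  c∉  = contradiction (c , c∈ , c∉) none

    consecutive-growth : Generates A → ∀ k {g} → g ∉ᵢ (1 + k) · A →
                         suc ((1 + k) * size A) ≤ size (k · A) + size ((1 + k) · A)
    consecutive-growth generates zero g∉ = begin
      suc (1 * size A)            ≡⟨ cong suc (*-identityˡ (size A)) ⟩
      1 + size A                  ≤⟨ +-mono-≤ (size-pos (0 · A) ε (ε∈0·A A)) (size-mono A (1 · A) (A⊆1·A A)) ⟩
      size (0 · A) + size (1 · A) ∎
      where open ≤-Reasoning
    consecutive-growth generates (suc k) {g} g∉ with new-element generates k (g∉ ∘ ·-step (1 + k) g)
    ... | c , c∈ , c∉ = begin
      suc (size A + (1 + k) * size A)                     ≡⟨ +-suc (size A) _ ⟨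
      size A + suc ((1 + k) * size A)                     ≤⟨ +-monoʳ-≤ (size A) previous ⟩
      size A + (size (k · A) + size ((1 + k) · A))        ≡⟨ +-assoc (size A) _ _ ⟨
      size A + size (k · A) + size ((1 + k) · A)          ≤⟨ +-monoˡ-≤ _ (growth k c∈ c∉) ⟩
      size ((2 + k) · A) + size ((1 + k) · A)             ≡⟨ +-comm (size ((2 + k) · A)) _ ⟩
      size ((1 + k) · A) + size ((2 + k) · A)             ∎
      where
      open ≤-Reasoning
      previous : suc ((1 + k) * size A) ≤ size (k · A) + size ((1 + k) · A)
      previous = consecutive-growth generates k (g∉ ∘ ·-step (1 + k) g)

    -- If 2n ≤ (j+2)|A| then every element is a sum of exactly j+1 elements of A:
    -- otherwise pigeonhole on 1 + j and consecutive growth would give (j+2)|A| < 2n.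
    covered : Generates A → ∀ j → 2 * n ≤ (2 + j) * size A → ∀ g → g ∈ᵢ (1 + j) · A
    covered generates j bound g with T? (((1 + j) · A) g)
    ... | yes g∈ = g∈
    ... | no  g∉ = contradiction bound (<⇒≱ (begin-strict
      size A + (1 + j) * size A                          <⟨ +-monoʳ-< (size A) (consecutive-growth generates j g∉) ⟩
      size A + (size (j · A) + size ((1 + j) · A))       ≡⟨ +-assoc (size A) _ _ ⟨
      size A + size (j · A) + size ((1 + j) · A)         ≤⟨ +-monoˡ-≤ _ (+-monoˡ-≤ _ (size-mono _ _ (A⊆1·A A))) ⟩
      size (1 · A) + size (j · A) + size ((1 + j) · A)   ≤⟨ +-mono-≤ (pigeonhole A 1 j g∉) (size≤n _) ⟩
      n + n                                              ≡⟨ cong (n +_) (+-identityʳ n) ⟨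
      2 * n                                              ∎))
      where open ≤-Reasoning

    covered′ : Generates A → ∀ c → 2 * n ≤ c * size A →
               ∃ λ j → c ≡ 2 + j × (∀ g → g ∈ᵢ (1 + j) · A)
    covered′ generates c bound with at-least-two c (size A) 1≤n (size≤n A) bound
      where
      1≤n : 1 ≤ n
      1≤n = >-nonZero⁻¹ n {{nonZeroIndex ε}}
    ... | j , refl = j , refl , covered generates j bound


∣p∣≡size : ∀ {n} (p : Subset n) → ∣ p ∣ ≡ size (lookup p)
∣p∣≡size []          = refl
∣p∣≡size (true ∷ p)  = cong suc (∣p∣≡size p)
∣p∣≡size (false ∷ p) = ∣p∣≡size p

module Width {n : ℕ} (_∙_ : Fin n → Fin n → Fin n) (ε : Fin n) (_⁻¹ : Fin n → Fin n)
             (isAbelianGroup : IsAbelianGroup _≡_ _∙_ ε _⁻¹) (A : Subset n) where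

  open FiniteAbelianGroup _∙_ ε _⁻¹ isAbelianGroup
  open Equivalence

  Aᵢ : Indicator n
  Aᵢ = lookup A

  ∈⇒∈ᵢ : ∀ {x} → x ∈ A → x ∈ᵢ Aᵢ
  ∈⇒∈ᵢ x∈A = from T-≡ ([]=⇒lookup x∈A)

  ∈ᵢ⇒∈ : ∀ {x} → x ∈ᵢ Aᵢ → x ∈ A
  ∈ᵢ⇒∈ {x} x∈A = lookup⇒[]= x A (to T-≡ x∈A)

  generates : NotInProperSubgroup _∙_ ε _⁻¹ A → Generates Aᵢ
  generates notInProper S (ε∈S , closed-∙ , closed-⁻¹) A⊆S x = into (notInProper H H-subgroup A⊆H x)
    where
    H : Subset n
    H = tabulate S
    into : ∀ {y} → y ∈ H → y ∈ᵢ S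
    into {y} y∈H = from T-≡ (trans (sym (lookup∘tabulate S y)) ([]=⇒lookup y∈H))
    outof : ∀ {y} → y ∈ᵢ S → y ∈ H
    outof {y} y∈S = lookup⇒[]= y H (trans (lookup∘tabulate S y) (to T-≡ y∈S))
    H-subgroup : IsSubgroup _∙_ ε _⁻¹ H
    H-subgroup = outof ε∈S
               , (λ x y x∈ y∈ → outof (closed-∙ x y (into x∈) (into y∈)))
               , (λ x x∈ → outof (closed-⁻¹ x (into x∈)))
    A⊆H : A ⊆ H
    A⊆H y∈A = outof (A⊆S _ (∈⇒∈ᵢ y∈A))

  to-InSumset : ∀ k {g} → g ∈ᵢ k · Aᵢ → InSumset _∙_ ε _⁻¹ k A g
  to-InSumset zero    g∈ = [] , [] , sym (0·A⊆ε Aᵢ g∈)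
  to-InSumset (suc k) {g} g∈ with ⊕-elim Aᵢ (k · Aᵢ) g∈
  ... | a , a∈A , g-a∈ with to-InSumset k g-a∈
  ...   | xs , xs⊆A , sum≡ = a ∷ xs , ∈ᵢ⇒∈ a∈A ∷ xs⊆A , trans (cong (a ∙_) sum≡) (∙-diff a g)

  from-InSumset : ∀ k {g} → InSumset _∙_ ε _⁻¹ k A g → g ∈ᵢ k · Aᵢ
  from-InSumset zero    ([] , [] , refl) = ε∈0·A Aᵢ
  from-InSumset (suc k) (a ∷ xs , a∈A ∷ xs⊆A , refl) =
    ⊕-intro Aᵢ (k · Aᵢ) (∈⇒∈ᵢ a∈A) (from-InSumset k (xs , xs⊆A , refl)) refl

  decide-Covers : ∀ k → Dec (Covers _∙_ ε _⁻¹ k A)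
  decide-Covers k = map′ covers uncovers
    (all? λ g → anyUpTo? (λ k′ → (1 ≤? k′) ×-dec T? ((k′ · Aᵢ) g)) (suc k))
    where
    covers : (∀ g → ∃ λ k′ → k′ < suc k × 1 ≤ k′ × g ∈ᵢ k′ · Aᵢ) → Covers _∙_ ε _⁻¹ k A
    covers h g with h g
    ... | k′ , k′<1+k , 1≤k′ , g∈ = k′ , 1≤k′ , s≤s⁻¹ k′<1+k , to-InSumset k′ g∈
    uncovers : Covers _∙_ ε _⁻¹ k A → ∀ g → ∃ λ k′ → k′ < suc k × 1 ≤ k′ × g ∈ᵢ k′ · Aᵢ
    uncovers cov g with cov g
    ... | k′ , 1≤k′ , k′≤k , g∈ = k′ , s≤s k′≤k , 1≤k′ , from-InSumset k′ g∈

  width≤ : ∀ B → Covers _∙_ ε _⁻¹ B A → ∃ λ w → IsWidth _∙_ ε _⁻¹ A w × w ≤ B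
  width≤ B cov with least-witness (λ k → Covers _∙_ ε _⁻¹ k A) decide-Covers B cov
  ... | w , w≤B , cov-w , least = w , (positive , cov-w , λ k _ → least k) , w≤B
    where
    positive : 1 ≤ w
    positive with cov-w ε
    ... | k′ , 1≤k′ , k′≤w , _ = ≤-trans 1≤k′ k′≤w

  covers-exactly : ∀ k → (∀ g → g ∈ᵢ (1 + k) · Aᵢ) → Covers _∙_ ε _⁻¹ (1 + k) A
  covers-exactly k all∈ g = 1 + k , s≤s z≤n , ≤-refl , to-InSumset (1 + k) (all∈ g)

  width-with-zero : Generates Aᵢ → ε ∈ A →
                    ∃ λ w → IsWidth _∙_ ε _⁻¹ A w × w ≤ ceilDiv (2 * n) ∣ A ∣ ∸ 1
  width-with-zero generates ε∈A = bound (covered′ generates c 2n≤c|A|)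
    where
    open SumsetsWithZero Aᵢ (∈⇒∈ᵢ ε∈A)
    c : ℕ
    c = ceilDiv (2 * n) ∣ A ∣
    1≤|A| : 1 ≤ ∣ A ∣
    1≤|A| = subst (1 ≤_) (sym (∣p∣≡size A)) (size-pos Aᵢ ε (∈⇒∈ᵢ ε∈A))
    2n≤c|A| : 2 * n ≤ c * size Aᵢ
    2n≤c|A| = subst (λ a → 2 * n ≤ c * a) (∣p∣≡size A) (ceilDiv-spec (2 * n) ∣ A ∣ 1≤|A|)
    bound : (∃ λ j → c ≡ 2 + j × (∀ g → g ∈ᵢ (1 + j) · Aᵢ)) →
            ∃ λ w → IsWidth _∙_ ε _⁻¹ A w × w ≤ c ∸ 1
    bound (j , c≡2+j , all∈) with width≤ (1 + j) (covers-exactly j all∈)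
    ... | w , isWidth , w≤1+j = w , isWidth , subst (w ≤_) (cong (_∸ 1) (sym c≡2+j)) w≤1+j

  -- Case ε ∉ A: run the first case for A ∪ {ε}, of size |A| + 1, then drop the summands
  -- ε; the element ε itself is a + a⁻¹ for some a ∈ A.
  width-without-zero : Generates Aᵢ → Nonempty A → ε ∉ A →
                       ∃ λ w → IsWidth _∙_ ε _⁻¹ A w × w ≤ ceilDiv (2 * n) (suc ∣ A ∣)
  width-without-zero generates (a , a∈A) ε∉A = bound (covered′ generates′ c 2n≤c|A′|)
    where
    A′ : Indicator n
    A′ = Aᵢ ∪ᵢ zero-set
    ε∈A′ : ε ∈ᵢ A′
    ε∈A′ = ∨-injʳ (ε∈0·A Aᵢ)
    open SumsetsWithZero A′ ε∈A′
    generates′ : Generates A′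
    generates′ S S-subgroup A′⊆S = generates S S-subgroup (λ x x∈A → A′⊆S x (∨-injˡ x∈A))

    c : ℕ
    c = ceilDiv (2 * n) (suc ∣ A ∣)
    1+|A|≤|A′| : suc ∣ A ∣ ≤ size A′
    1+|A|≤|A′| = subst (λ k → suc k ≤ size A′) (sym (∣p∣≡size A))
                       (size-strict Aᵢ A′ (λ _ → ∨-injˡ) ε ε∈A′ (λ ε∈ → ε∉A (∈ᵢ⇒∈ ε∈)))
    2n≤c|A′| : 2 * n ≤ c * size A′
    2n≤c|A′| = ≤-trans (ceilDiv-spec (2 * n) (suc ∣ A ∣) (s≤s z≤n)) (*-monoʳ-≤ c 1+|A|≤|A′|)

    covers-2+j : ∀ j → (∀ g → g ∈ᵢ (1 + j) · A′) → Covers _∙_ ε _⁻¹ (2 + j) A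
    covers-2+j j all∈ g with drop-zeros Aᵢ (1 + j) (all∈ g)
    ... | suc k , 1+k≤1+j , g∈ = suc k , s≤s z≤n , m≤n⇒m≤1+n 1+k≤1+j , to-InSumset (suc k) g∈
    ... | zero  , _       , g∈ with drop-zeros Aᵢ (1 + j) (all∈ (a ⁻¹))
    ...   | k , k≤1+j , a⁻¹∈ = suc k , s≤s z≤n , s≤s k≤1+j , to-InSumset (suc k) g∈1+k
      where
      g∈1+k : g ∈ᵢ (1 + k) · Aᵢ
      g∈1+k = ⊕-intro Aᵢ (k · Aᵢ) (∈⇒∈ᵢ a∈A) a⁻¹∈
                      (trans (IsAbelianGroup.inverseʳ isAbelianGroup a) (sym (0·A⊆ε Aᵢ g∈)))

    bound : (∃ λ j → c ≡ 2 + j × (∀ g → g ∈ᵢ (1 + j) · A′)) →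
            ∃ λ w → IsWidth _∙_ ε _⁻¹ A w × w ≤ c
    bound (j , c≡2+j , all∈) with width≤ (2 + j) (covers-2+j j all∈)
    ... | w , isWidth , w≤2+j = w , isWidth , subst (w ≤_) (sym c≡2+j) w≤2+j

lemma3 : (n : ℕ) (_∙_ : Fin n → Fin n → Fin n) (ε : Fin n) (_⁻¹ : Fin n → Fin n) →
         IsAbelianGroup _≡_ _∙_ ε _⁻¹ →
         (A : Subset n) → Nonempty A → NotInProperSubgroup _∙_ ε _⁻¹ A →
         ∃ λ w → IsWidth _∙_ ε _⁻¹ A w
           × (ε ∈ A → w ≤ ceilDiv (2 * n) ∣ A ∣ ∸ 1)
           × (ε ∉ A → w ≤ ceilDiv (2 * n) (suc ∣ A ∣))
lemma3 n _∙_ ε _⁻¹ isAbelianGroup A nonempty notInProper = by-cases (ε ∈? A)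
  where
  open Width _∙_ ε _⁻¹ isAbelianGroup A
  by-cases : Dec (ε ∈ A) →
             ∃ λ w → IsWidth _∙_ ε _⁻¹ A w
               × (ε ∈ A → w ≤ ceilDiv (2 * n) ∣ A ∣ ∸ 1)
               × (ε ∉ A → w ≤ ceilDiv (2 * n) (suc ∣ A ∣))
  by-cases (yes ε∈A) = map₂ (λ (isWidth , w≤) → isWidth , const w≤ , contradiction ε∈A)
                              (width-with-zero (generates notInProper) ε∈A)
  by-cases (no ε∉A)  = map₂ (λ (isWidth , w≤) → isWidth , (λ ε∈A → contradiction ε∈A ε∉A) , const w≤)
                              (width-without-zero (generates notInProper) nonempty ε∉A)
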